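{- Let $G$ be a graph and let $r$ be a positive integer. Then $\widetilde\nabla_r(G)\leq \mathrm{adm}_{2r+1}(G)$.
   Context: All graphs are finite, simple, undirected. A graph $H$ is a topological depth-$r$ minor of $G$ if there is an injective map $T:V(H)\to V(G)$ and for each edge $e=uv\in E(H)$ a path $T(e)$ in $G$ of length at most $2r+1$ between $T(u)$ and $T(v)$, the paths being pairwise internally vertex-disjoint. $\widetilde\nabla_r(G)=\sup\{|E(H)|/|V(H)|: H\text{ a topological depth- }r\text{ minor of }G\}$. For a linear order $\pi=(v_1,\dots,v_n)$ of $V(G)$ and $V_i=\{v_1,\dots,v_i\}$, a depth-$s$ $v$-$A$ fan is a set of paths of length at most $s$, each with one endpoint $v$ and other endpoint in $A$, internally disjoint from $A$, pairwise meeting only in $v$ (the length-$0$ path allowed if $v\in A$); $\mathrm{adm}_s(G)=\min_\pi\max_i(\text{maximum size of a depth- }s\ v_i\text{ - }V_i\text{ fan})$. -}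

module Defs where

open import Data.Nat using (ℕ; zero; suc; _+_; _*_; _≤_; _<_; _<ᵇ_)
open import Data.Bool using (Bool; true; false; if_then_else_; _∧_)
open import Data.Fin using (Fin; toℕ)
open import Data.List using (List; []; _∷_; _++_; length; map; allFin)
open import Data.Nat.ListAction using (sum)
open import Data.List.Relation.Unary.All using (All)
open import Data.List.Relation.Unary.Linked using (Linked)
open import Data.List.Relation.Unary.AllPairs using (AllPairs)
open import Data.List.Relation.Unary.Unique.Propositional using (Unique)
open import Data.List.Membership.Propositional using (_∈_)
open import Data.Product using (Σ; _×_; _,_)
open import Data.Sum using (_⊎_)
open import Data.Empty using (⊥)
open import Relation.Nullary using (¬_)
open import Relation.Binary.PropositionalEquality using (_≡_)
open import Function.Definitions using (Injective)

record Graph (n : ℕ) : Set where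
  field
    adj   : Fin n → Fin n → Bool
    sym   : ∀ x y → adj x y ≡ adj y x
    irrefl : ∀ x → adj x x ≡ false

open Graph public

Adj : ∀ {n} → Graph n → Fin n → Fin n → Set
Adj G x y = adj G x y ≡ true

Edge : ∀ {n} → Graph n → Fin n → Fin n → Set
Edge G u v = (toℕ u < toℕ v) × Adj G u v

edgeCount : ∀ {n} → Graph n → ℕ
edgeCount {n} G =
  sum (map (λ u → sum (map (λ v → if (toℕ u <ᵇ toℕ v) ∧ adj G u v then 1 else 0)
                           (allFin n)))
           (allFin n))

-- A path in G given by its full vertex list: consecutive vertices adjacent,
-- all vertices distinct.  Its length is (number of vertices) - 1.
IsPath : ∀ {n} → Graph n → List (Fin n) → Set
IsPath G p = Linked (Adj G) p × Unique p

-- A path from a to b whose list of internal vertices is mid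
-- (full vertex list a ∷ mid ++ [b], length = length mid + 1).
PathVia : ∀ {n} → Graph n → Fin n → List (Fin n) → Fin n → Set
PathVia G a mid b = IsPath G (a ∷ mid ++ b ∷ [])

-- T : V(H) → V(G) injective; P u v = internal vertices of the path T(uv)
-- for each edge uv of H (u < v); length ≤ 2r+1; paths for distinct edges
-- pairwise internally vertex-disjoint (no internal vertex of one lies on
-- the other).
TopMinor : ∀ {m n} → ℕ → Graph m → Graph n → Set
TopMinor {m} {n} r H G =
  Σ (Fin m → Fin n) λ T → Injective _≡_ _≡_ T ×
  Σ (Fin m → Fin m → List (Fin n)) λ P →
    (∀ u v → Edge H u v →
       PathVia G (T u) (P u v) (T v) × suc (length (P u v)) ≤ suc (2 * r)) ×
    (∀ u v u' v' → Edge H u v → Edge H u' v' → ¬ (u ≡ u' × v ≡ v') →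
       ∀ x → x ∈ P u v → x ∈ (T u' ∷ P u' v' ++ T v' ∷ []) → ⊥)

-- A path of a v-A fan is given by its full vertex list starting at v.
FanPath : ∀ {n} → ℕ → Graph n → Fin n → (Fin n → Set) → List (Fin n) → Set
FanPath {n} s G v A p =
  (p ≡ v ∷ [] × A v) ⊎
  Σ (List (Fin n)) λ mid → Σ (Fin n) λ e →
    (p ≡ v ∷ mid ++ e ∷ []) × A e × All (λ x → ¬ A x) mid ×
    IsPath G p × suc (length mid) ≤ s

-- A depth-s v-A fan: a set (list without repetition) of such paths,
-- pairwise meeting only in v.  Its size is the length of the list.
Fan : ∀ {n} → ℕ → Graph n → Fin n → (Fin n → Set) → List (List (Fin n)) → Set
Fan s G v A ps =
  All (FanPath s G v A) ps × Unique ps ×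
  AllPairs (λ p q → ∀ x → x ∈ p → x ∈ q → x ≡ v) ps

-- For a linear order π (a bijection Fin n → Fin n, v_i = π i),
-- V_i = {π j : j ≤ i}.
Prefix : ∀ {n} → (Fin n → Fin n) → Fin n → Fin n → Set
Prefix {n} π i x = Σ (Fin n) λ j → (toℕ j ≤ toℕ i) × π j ≡ x

-- adm_s(G) ≤ k : some linear order π such that for every i, every depth-s
-- v_i-V_i fan has size at most k  (adm_s = min_π max_i max fan size).
AdmAtMost : ∀ {n} → ℕ → Graph n → ℕ → Set
AdmAtMost {n} s G k =
  Σ (Fin n → Fin n) λ π → Injective _≡_ _≡_ π ×
    (∀ i (ps : List (List (Fin n))) → Fan s G (π i) (Prefix π i) ps → length ps ≤ k)

-- Orient every edge of H towards the endpoint whose branch vertex comes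
-- first in an admissibility order π of G.  For a vertex u of H, the model
-- paths from T u to its lower neighbours meet only in T u and end in the
-- prefix of π up to T u; cutting each at its first vertex in that prefix
-- gives a depth-(2r+1) fan, so u has at most adm_{2r+1}(G) lower
-- neighbours.  Every edge is counted exactly once at its upper endpoint.
module Submission where

open import Defs hiding (sym)
open import Data.Nat using (ℕ; suc; _*_; _≤_)

open import Level using (Level)
open import Data.Nat using (zero; _+_; _<_; _<ᵇ_; z≤n; s≤s; s≤s⁻¹; _≤?_)
open import Data.Nat.Properties
  using (+-identityʳ; +-comm; *-comm; *-cancelˡ-≡; +-mono-≤; <⇒≤; ≮⇒≥; ≤∧≢⇒<; <ᵇ⇒<; n<1+n; module ≤-Reasoning)
open import Data.Nat.ListAction using (sum)
open import Data.Bool using (Bool; true; false; if_then_else_; _∧_; T)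
open import Data.Bool.Properties using (∧-zeroʳ; ∧-identityʳ; T-∧; T-≡)
open import Data.Fin using (Fin; toℕ; punchOut) renaming (zero to fzero; suc to fsuc)
open import Data.Fin.Properties using (toℕ-injective; punchOut-injective; any?; <⇒notInjective; _<?_; _≟_)
open import Data.List using (List; []; _∷_; _++_; _ʳ++_; length; map; reverse; filter; tabulate; allFin)
open import Data.List.Properties using (length-++; length-++-≤ˡ; length-map; length-reverse; reverse-++; ∷-injectiveʳ)
open import Data.List.Relation.Unary.All as All using (All; []; _∷_)
open import Data.List.Relation.Unary.All.Properties using (all-filter) renaming (map⁺ to All-map⁺; ++⁻ˡ to All-++⁻ˡ)
open import Data.List.Relation.Unary.Any using (Any; here; there)
open import Data.List.Relation.Unary.Any.Properties using (++⁺ʳ; reverse⁻)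
open import Data.List.Relation.Unary.Linked using (Linked; []; [-]; _∷_)
open import Data.List.Relation.Unary.AllPairs as AllPairs using (AllPairs; []; _∷_)
open import Data.List.Relation.Unary.AllPairs.Properties using () renaming (map⁺ to AllPairs-map⁺)
open import Data.List.Relation.Unary.Unique.Propositional using (Unique)
open import Data.List.Relation.Unary.Unique.Propositional.Properties using (allFin⁺) renaming (filter⁺ to Unique-filter⁺)
open import Data.List.Relation.Binary.Disjoint.Propositional using (Disjoint)
open import Data.List.Relation.Binary.Permutation.Propositional using (↭-sym; ↭⇒↭ₛ)
open import Data.List.Relation.Binary.Permutation.Propositional.Properties using (↭-reverse)
open import Data.List.Membership.Propositional using (_∈_)
open import Data.List.Membership.Propositional.Properties using (∈-++⁺ˡ; ∈-++⁻)
open import Data.Product using (∃; ∃₂; _×_; _,_; proj₁; proj₂; uncurry; map₂)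
open import Data.Product.Properties using (,-injective)
open import Data.Sum using (inj₁; inj₂)
open import Data.Empty using (⊥; ⊥-elim)
open import Function using (_∘_; id; Injective; Equivalence)
open import Relation.Binary using (Rel; Symmetric)
open import Relation.Binary.PropositionalEquality
  using (_≡_; _≢_; refl; sym; trans; cong; cong₂; subst; setoid; module ≡-Reasoning)
open import Relation.Nullary using (¬_; yes; no; contradiction)
open import Relation.Nullary.Decidable using (T?; _×-dec_)
open import Relation.Unary using (Pred; Decidable)
open import Algebra.Properties.CommutativeMonoid.Sum Data.Nat.Properties.+-0-commutativeMonoid
  using (sum-syntax; ∑-comm; ∑-distrib-+; sum-cong-≗)

import Data.List.Relation.Binary.Permutation.Setoid.Properties as SetoidPermutation

private
  variable
    a ℓ p : Level
    A : Set a

module _ {R : Rel A ℓ} where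

  Linked-ʳ++ : Symmetric R → ∀ {x xs acc} →
               Linked R (x ∷ xs) → Linked R (x ∷ acc) → Linked R (xs ʳ++ x ∷ acc)
  Linked-ʳ++ R-sym [-]       acc = acc
  Linked-ʳ++ R-sym (r ∷ rxs) acc = Linked-ʳ++ R-sym rxs (R-sym r ∷ acc)

  Linked-reverse : Symmetric R → ∀ {xs} → Linked R xs → Linked R (reverse xs)
  Linked-reverse R-sym {[]}    []  = []
  Linked-reverse R-sym {_ ∷ _} rxs = Linked-ʳ++ R-sym rxs [-]

  Linked-++⁻ˡ : ∀ xs {ys} → Linked R (xs ++ ys) → Linked R xs
  Linked-++⁻ˡ []           _         = []
  Linked-++⁻ˡ (x ∷ [])     _         = [-]
  Linked-++⁻ˡ (x ∷ y ∷ xs) (r ∷ rxs) = r ∷ Linked-++⁻ˡ (y ∷ xs) rxs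

  AllPairs-++⁻ˡ : ∀ xs {ys} → AllPairs R (xs ++ ys) → AllPairs R xs
  AllPairs-++⁻ˡ []       _          = []
  AllPairs-++⁻ˡ (x ∷ xs) (rx ∷ rxs) = All-++⁻ˡ xs rx ∷ AllPairs-++⁻ˡ xs rxs

AllPairs-zip : ∀ {P : Pred A p} {R S : Rel A ℓ} →
               (∀ {x y} → P x → P y → R x y → S x y) →
               ∀ {xs} → All P xs → AllPairs R xs → AllPairs S xs
AllPairs-zip f []         []         = []
AllPairs-zip f (px ∷ pxs) (rxs ∷ rs) =
  All.zipWith (λ (py , rxy) → f px py rxy) (pxs , rxs) ∷ AllPairs-zip f pxs rs

Unique-reverse : ∀ {xs : List A} → Unique xs → Unique (reverse xs)
Unique-reverse {A = A} {xs} =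
  SetoidPermutation.Unique-resp-↭ (setoid A) (↭⇒↭ₛ (↭-sym (↭-reverse xs)))

reverse-between : ∀ (x : A) xs y → reverse (x ∷ xs ++ y ∷ []) ≡ y ∷ reverse xs ++ x ∷ []
reverse-between x xs y = begin
  reverse (x ∷ xs ++ y ∷ [])            ≡⟨ reverse-++ (x ∷ xs) (y ∷ []) ⟩
  y ∷ reverse (x ∷ xs)                  ≡⟨ cong (y ∷_) (reverse-++ (x ∷ []) xs) ⟩
  y ∷ reverse xs ++ x ∷ []              ∎
  where open ≡-Reasoning

module _ {P : Pred A p} (P? : Decidable P) where

  upToFirst : List A → List A
  upToFirst []       = []
  upToFirst (x ∷ xs) with P? x
  ... | yes _ = x ∷ []
  ... | no  _ = x ∷ upToFirst xs

  upToFirst-prefix : ∀ xs → ∃ λ rest → upToFirst xs ++ rest ≡ xs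
  upToFirst-prefix []       = [] , refl
  upToFirst-prefix (x ∷ xs) with P? x
  ... | yes _ = xs , refl
  ... | no  _ = map₂ (cong (x ∷_)) (upToFirst-prefix xs)

  upToFirst-⊆ : ∀ {xs y} → y ∈ upToFirst xs → y ∈ xs
  upToFirst-⊆ {xs} y∈ with upToFirst-prefix xs
  ... | rest , prefix = subst (_ ∈_) prefix (∈-++⁺ˡ y∈)

  upToFirst-length : ∀ xs → length (upToFirst xs) ≤ length xs
  upToFirst-length xs with upToFirst-prefix xs
  ... | rest , prefix = subst (length (upToFirst xs) ≤_) (cong length prefix) (length-++-≤ˡ (upToFirst xs))

  upToFirst-head : ∀ x xs → x ∈ upToFirst (x ∷ xs)
  upToFirst-head x xs with P? x
  ... | yes _ = here refl
  ... | no  _ = here refl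

  upToFirst-view : ∀ {xs} → Any P xs →
                   ∃₂ λ mid e → upToFirst xs ≡ mid ++ e ∷ [] × All (λ x → ¬ P x) mid × P e
  upToFirst-view {x ∷ xs} hit with P? x | hit
  ... | yes px  | _          = [] , x , refl , [] , px
  ... | no  ¬px | here px    = contradiction px ¬px
  ... | no  ¬px | there hit′ with upToFirst-view hit′
  ...   | mid , e , eq , outside , pe = x ∷ mid , e , cong (x ∷_) eq , ¬px ∷ outside , pe

module _ {n} (G : Graph n) where

  Adj-sym : ∀ {x y} → Adj G x y → Adj G y x
  Adj-sym {x} {y} xy = trans (Graph.sym G y x) xy

  Adj⇒≢ : ∀ {x y} → Adj G x y → x ≢ y
  Adj⇒≢ {x} loop refl with trans (sym loop) (irrefl G x)
  ... | ()

  IsPath-++⁻ˡ : ∀ xs {ys} → IsPath G (xs ++ ys) → IsPath G xs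
  IsPath-++⁻ˡ xs (linked , unique) = Linked-++⁻ˡ xs linked , AllPairs-++⁻ˡ xs unique

  PathVia-reverse : ∀ {x mid y} → PathVia G x mid y → PathVia G y (reverse mid) x
  PathVia-reverse {x} {mid} {y} (linked , unique) =
    subst (IsPath G) (reverse-between x mid y) (Linked-reverse Adj-sym linked , Unique-reverse unique)

Branch : ∀ {n} → ℕ → Graph n → Fin n → (Fin n → Set) → List (Fin n) → Set
Branch s G v A ys = IsPath G (v ∷ ys) × length ys ≤ s × Any A ys

module _ {n} {A : Fin n → Set} (A? : Decidable A) (v : Fin n) where

  truncate : List (Fin n) → List (Fin n)
  truncate ys = v ∷ upToFirst A? ys

  Branch⇒FanPath : ∀ {s G ys} → Branch s G v A ys → FanPath s G v A (truncate ys)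
  Branch⇒FanPath {s} {G} {ys} (path , short , hit) with upToFirst-view A? hit | upToFirst-prefix A? ys
  ... | mid , e , eq , outside , Ae | rest , prefix =
    inj₂ (mid , e , cong (v ∷_) eq , Ae , outside , IsPath-++⁻ˡ G (truncate ys) path′ , short′)
    where
    open ≤-Reasoning
    path′ : IsPath G (truncate ys ++ rest)
    path′ = subst (λ zs → IsPath G (v ∷ zs)) (sym prefix) path
    short′ : suc (length mid) ≤ s
    short′ = begin
      suc (length mid)          ≡⟨ +-comm 1 (length mid) ⟩
      length mid + 1            ≡⟨ sym (length-++ mid) ⟩
      length (mid ++ e ∷ [])    ≡⟨ cong length (sym eq) ⟩
      length (upToFirst A? ys)  ≤⟨ upToFirst-length A? ys ⟩
      length ys                 ≤⟨ short ⟩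
      s                         ∎

  truncate-meet : ∀ {ys ys′} → Disjoint ys ys′ →
                  ∀ x → x ∈ truncate ys → x ∈ truncate ys′ → x ≡ v
  truncate-meet _        x (here x≡v) _            = x≡v
  truncate-meet _        x (there _)  (here x≡v)   = x≡v
  truncate-meet disjoint x (there x∈) (there x∈′) =
    ⊥-elim (disjoint (upToFirst-⊆ A? x∈ , upToFirst-⊆ A? x∈′))

  truncate-≢ : ∀ {ys ys′} → Any A ys → Disjoint ys ys′ → truncate ys ≢ truncate ys′
  truncate-≢ {y ∷ ys} _ disjoint eq =
    disjoint (here refl , upToFirst-⊆ A? (subst (y ∈_) (∷-injectiveʳ eq) (upToFirst-head A? y ys)))

  fanOfBranches : ∀ {s G bs} → All (Branch s G v A) bs → AllPairs Disjoint bs →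
                  Fan s G v A (map truncate bs)
  fanOfBranches {s} {G} branches disjoint =
      All-map⁺ (All.map (Branch⇒FanPath {s} {G}) branches)
    , AllPairs-map⁺ (AllPairs-zip (λ (_ , _ , hit) _ → truncate-≢ hit) branches disjoint)
    , AllPairs-map⁺ (AllPairs.map truncate-meet disjoint)

-- Counting edges by orientation

⟦_⟧ : Bool → ℕ
⟦ b ⟧ = if b then 1 else 0

sum-map-tabulate : ∀ {n} (f : A → ℕ) (g : Fin n → A) →
                   sum (map f (tabulate g)) ≡ ∑[ i < n ] f (g i)
sum-map-tabulate {n = zero}  f g = refl
sum-map-tabulate {n = suc n} f g = cong (f (g fzero) +_) (sum-map-tabulate f (g ∘ fsuc))

sum-⟦⟧≡length-filter : ∀ (b : A → Bool) xs → sum (map (⟦_⟧ ∘ b) xs) ≡ length (filter (T? ∘ b) xs)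
sum-⟦⟧≡length-filter b []       = refl
sum-⟦⟧≡length-filter b (x ∷ xs) with b x
... | true  = cong suc (sum-⟦⟧≡length-filter b xs)
... | false = sum-⟦⟧≡length-filter b xs

∑-bounded : ∀ {m k} (f : Fin m → ℕ) → (∀ i → f i ≤ k) → ∑[ i < m ] f i ≤ m * k
∑-bounded {zero}  f _   = z≤n
∑-bounded {suc m} f f≤k = +-mono-≤ (f≤k fzero) (∑-bounded (f ∘ fsuc) (f≤k ∘ fsuc))

⟦<ᵇ⟧+⟦>ᵇ⟧ : ∀ x y → x ≢ y → ⟦ x <ᵇ y ⟧ + ⟦ y <ᵇ x ⟧ ≡ 1
⟦<ᵇ⟧+⟦>ᵇ⟧ zero    zero    x≢y = contradiction refl x≢y
⟦<ᵇ⟧+⟦>ᵇ⟧ zero    (suc y) _   = refl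
⟦<ᵇ⟧+⟦>ᵇ⟧ (suc x) zero    _   = refl
⟦<ᵇ⟧+⟦>ᵇ⟧ (suc x) (suc y) x≢y = ⟦<ᵇ⟧+⟦>ᵇ⟧ x y (x≢y ∘ cong suc)

⟦∧⟧-orient : ∀ b b′ e → (e ≡ true → ⟦ b ⟧ + ⟦ b′ ⟧ ≡ 1) → ⟦ b ∧ e ⟧ + ⟦ b′ ∧ e ⟧ ≡ ⟦ e ⟧
⟦∧⟧-orient b b′ false _   rewrite ∧-zeroʳ b | ∧-zeroʳ b′ = refl
⟦∧⟧-orient b b′ true  one rewrite ∧-identityʳ b | ∧-identityʳ b′ = one refl

pairCount : ∀ {m} → (Fin m → Fin m → Bool) → ℕ
pairCount {m} R = ∑[ u < m ] ∑[ v < m ] ⟦ R u v ⟧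

-- Of the two ordered pairs (u, v) and (v, u) of an E-edge, exactly one is
-- selected by lt, so the oriented pairs are half of all E-pairs.
pairCount-orient : ∀ {m} (E lt : Fin m → Fin m → Bool) → (∀ u v → E u v ≡ E v u) →
                   (∀ u v → E u v ≡ true → ⟦ lt u v ⟧ + ⟦ lt v u ⟧ ≡ 1) →
                   2 * pairCount (λ u v → lt u v ∧ E u v) ≡ pairCount E
pairCount-orient {m} E lt E-sym tournament = begin
  2 * pairCount L                                          ≡⟨ cong (pairCount L +_) (+-identityʳ _) ⟩
  pairCount L + pairCount L                                ≡⟨ cong (pairCount L +_) (∑-comm (λ u v → ⟦ L u v ⟧)) ⟩
  pairCount L + ∑[ u < m ] ∑[ v < m ] ⟦ L v u ⟧           ≡⟨ sym (∑-distrib-+ (λ u → ∑[ v < m ] ⟦ L u v ⟧) (λ u → ∑[ v < m ] ⟦ L v u ⟧)) ⟩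
  ∑[ u < m ] (∑[ v < m ] ⟦ L u v ⟧ + ∑[ v < m ] ⟦ L v u ⟧) ≡⟨ sum-cong-≗ (λ u → sym (∑-distrib-+ (λ v → ⟦ L u v ⟧) (λ v → ⟦ L v u ⟧))) ⟩
  ∑[ u < m ] ∑[ v < m ] (⟦ L u v ⟧ + ⟦ L v u ⟧)            ≡⟨ sum-cong-≗ (λ u → sum-cong-≗ (pairwise u)) ⟩
  pairCount E                                              ∎
  where
  open ≡-Reasoning
  L : Fin m → Fin m → Bool
  L u v = lt u v ∧ E u v
  pairwise : ∀ u v → ⟦ L u v ⟧ + ⟦ L v u ⟧ ≡ ⟦ E u v ⟧
  pairwise u v rewrite E-sym v u = ⟦∧⟧-orient (lt u v) (lt v u) (E u v) (tournament u v)

isLowerNeighbour : ∀ {m} → Graph m → (Fin m → ℕ) → Fin m → Fin m → Bool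
isLowerNeighbour H ρ u v = (ρ v <ᵇ ρ u) ∧ adj H u v

lowerNeighbours : ∀ {m} → Graph m → (Fin m → ℕ) → Fin m → List (Fin m)
lowerNeighbours {m} H ρ u = filter (T? ∘ isLowerNeighbour H ρ u) (allFin m)

lowerDegree : ∀ {m} → Graph m → (Fin m → ℕ) → Fin m → ℕ
lowerDegree H ρ u = length (lowerNeighbours H ρ u)

module _ {m} (H : Graph m) (ρ : Fin m → ℕ) where

  lowerNeighbours-lower : ∀ u → All (λ v → Adj H u v × ρ v < ρ u) (lowerNeighbours H ρ u)
  lowerNeighbours-lower u = All.map lower (all-filter (T? ∘ isLowerNeighbour H ρ u) (allFin m))
    where
    lower : ∀ {v} → T (isLowerNeighbour H ρ u v) → Adj H u v × ρ v < ρ u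
    lower {v} t with Equivalence.to T-∧ t
    ... | v<u , uv = Equivalence.to T-≡ uv , <ᵇ⇒< (ρ v) (ρ u) v<u

  lowerNeighbours-unique : ∀ u → Unique (lowerNeighbours H ρ u)
  lowerNeighbours-unique u = Unique-filter⁺ (T? ∘ isLowerNeighbour H ρ u) (allFin⁺ m)

  edgeCount≡∑lowerDegree : Injective _≡_ _≡_ ρ → edgeCount H ≡ ∑[ u < m ] lowerDegree H ρ u
  edgeCount≡∑lowerDegree ρ-injective = *-cancelˡ-≡ _ _ 2 (begin
    2 * edgeCount H                                   ≡⟨ cong (2 *_) asPairs ⟩
    2 * pairCount (λ u v → (toℕ u <ᵇ toℕ v) ∧ adj H u v) ≡⟨ pairCount-orient (adj H) _ symmetric (ranked toℕ toℕ-injective) ⟩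
    pairCount (adj H)                                 ≡⟨ sym (pairCount-orient (adj H) _ symmetric (λ u v uv → ranked ρ ρ-injective v u (Adj-sym H uv))) ⟩
    2 * pairCount (isLowerNeighbour H ρ)              ≡⟨ cong (2 *_) (sum-cong-≗ asLength) ⟩
    2 * ∑[ u < m ] lowerDegree H ρ u                  ∎)
    where
    open ≡-Reasoning
    symmetric : ∀ u v → adj H u v ≡ adj H v u
    symmetric = Graph.sym H
    ranked : ∀ (σ : Fin m → ℕ) → Injective _≡_ _≡_ σ →
             ∀ u v → Adj H u v → ⟦ σ u <ᵇ σ v ⟧ + ⟦ σ v <ᵇ σ u ⟧ ≡ 1
    ranked σ σ-injective u v uv = ⟦<ᵇ⟧+⟦>ᵇ⟧ (σ u) (σ v) (Adj⇒≢ H uv ∘ σ-injective)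
    asPairs : edgeCount H ≡ pairCount (λ u v → (toℕ u <ᵇ toℕ v) ∧ adj H u v)
    asPairs = trans (sum-map-tabulate (λ u → sum (map (forward u) (allFin m))) id)
                    (sum-cong-≗ (λ u → sum-map-tabulate (forward u) id))
      where
      forward : Fin m → Fin m → ℕ
      forward u v = ⟦ (toℕ u <ᵇ toℕ v) ∧ adj H u v ⟧
    asLength : ∀ u → ∑[ v < m ] ⟦ isLowerNeighbour H ρ u v ⟧ ≡ lowerDegree H ρ u
    asLength u = trans (sym (sum-map-tabulate (⟦_⟧ ∘ isLowerNeighbour H ρ u) id))
                       (sum-⟦⟧≡length-filter (isLowerNeighbour H ρ u) (allFin m))

Fin-injective⇒surjective : ∀ {n} {f : Fin n → Fin n} → Injective _≡_ _≡_ f → ∀ y → ∃ λ x → f x ≡ y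
Fin-injective⇒surjective {suc n} {f} f-injective y with any? (λ x → f x ≟ y)
... | yes found = found
... | no  missed = ⊥-elim (<⇒notInjective {f = squeeze} (n<1+n n) squeeze-injective)
  where
  y≢f : ∀ x → y ≢ f x
  y≢f x y≡fx = missed (x , sym y≡fx)
  squeeze : Fin (suc n) → Fin n
  squeeze x = punchOut (y≢f x)
  squeeze-injective : Injective _≡_ _≡_ squeeze
  squeeze-injective eq = f-injective (punchOut-injective (y≢f _) (y≢f _) eq)

-- Topological minors

module MinorModel {m n r} {H : Graph m} {G : Graph n}
  (T : Fin m → Fin n) (T-injective : Injective _≡_ _≡_ T) (P : Fin m → Fin m → List (Fin n))
  (edgePath : ∀ u v → Edge H u v → PathVia G (T u) (P u v) (T v) × suc (length (P u v)) ≤ suc (2 * r))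
  (internallyDisjoint : ∀ u v u′ v′ → Edge H u v → Edge H u′ v′ → ¬ (u ≡ u′ × v ≡ v′) →
                        ∀ x → x ∈ P u v → x ∈ (T u′ ∷ P u′ v′ ++ T v′ ∷ []) → ⊥)
  where

  orient : Fin m → Fin m → Fin m × Fin m
  orient u w with u <? w
  ... | yes _ = u , w
  ... | no  _ = w , u

  inner : Fin m → Fin m → List (Fin n)
  inner u w with u <? w
  ... | yes _ = P u w
  ... | no  _ = reverse (P w u)

  modelPath : Fin m × Fin m → List (Fin n)
  modelPath (a , b) = T a ∷ P a b ++ T b ∷ []

  orient-Edge : ∀ {u w} → Adj H u w → uncurry (Edge H) (orient u w)
  orient-Edge {u} {w} uw with u <? w
  ... | yes u<w = u<w , uw
  ... | no  u≮w = ≤∧≢⇒< (≮⇒≥ u≮w) (Adj⇒≢ H uw ∘ toℕ-injective ∘ sym) , Adj-sym H uw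

  orient-injective : ∀ {u w w′} → u ≢ w → u ≢ w′ → orient u w ≡ orient u w′ → w ≡ w′
  orient-injective {u} {w} {w′} u≢w u≢w′ eq with u <? w | u <? w′
  ... | yes _ | yes _ = proj₂ (,-injective eq)
  ... | yes _ | no  _ = contradiction (proj₁ (,-injective eq)) u≢w′
  ... | no  _ | yes _ = contradiction (sym (proj₁ (,-injective eq))) u≢w
  ... | no  _ | no  _ = proj₁ (,-injective eq)

  inner-path : ∀ {u w} → Adj H u w → PathVia G (T u) (inner u w) (T w) × length (inner u w) ≤ 2 * r
  inner-path {u} {w} uw with u <? w | orient-Edge uw
  ... | yes _ | e = proj₁ (edgePath u w e) , s≤s⁻¹ (proj₂ (edgePath u w e))
  ... | no  _ | e = PathVia-reverse G (proj₁ (edgePath w u e))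
                  , subst (_≤ 2 * r) (sym (length-reverse (P w u))) (s≤s⁻¹ (proj₂ (edgePath w u e)))

  inner-⊆ : ∀ {u w x} → x ∈ inner u w → x ∈ uncurry P (orient u w)
  inner-⊆ {u} {w} x∈ with u <? w
  ... | yes _ = x∈
  ... | no  _ = reverse⁻ x∈

  route-⊆ : ∀ {u w x} → x ∈ T u ∷ inner u w ++ T w ∷ [] → x ∈ modelPath (orient u w)
  route-⊆ {u} {w} x∈ with u <? w
  ... | yes _ = x∈
  ... | no  _ = reverse⁻ (subst (_ ∈_) (sym (reverse-between (T w) (P w u) (T u))) x∈)

  inner-avoids-route : ∀ {u w w′ x} → Adj H u w → Adj H u w′ → w ≢ w′ →
                       x ∈ inner u w → x ∈ T u ∷ inner u w′ ++ T w′ ∷ [] → ⊥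
  inner-avoids-route {u} {w} {w′} uw uw′ w≢w′ x∈ x∈′ =
    internallyDisjoint _ _ _ _ (orient-Edge uw) (orient-Edge uw′) distinct _
                       (inner-⊆ {u} {w} x∈) (route-⊆ {u} {w′} x∈′)
    where
    distinct : ¬ (proj₁ (orient u w) ≡ proj₁ (orient u w′) × proj₂ (orient u w) ≡ proj₂ (orient u w′))
    distinct (eq₁ , eq₂) = w≢w′ (orient-injective (Adj⇒≢ H uw) (Adj⇒≢ H uw′) (cong₂ _,_ eq₁ eq₂))

  star-disjoint : ∀ {u w w′} → Adj H u w → Adj H u w′ → w ≢ w′ →
                  Disjoint (inner u w ++ T w ∷ []) (inner u w′ ++ T w′ ∷ [])
  star-disjoint {u} {w} {w′} uw uw′ w≢w′ (x∈ , x∈′) with ∈-++⁻ (inner u w) x∈ | ∈-++⁻ (inner u w′) x∈′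
  ... | inj₁ x∈inner | _                = inner-avoids-route uw uw′ w≢w′ x∈inner (there x∈′)
  ... | inj₂ _       | inj₁ x∈inner′    = inner-avoids-route uw′ uw (w≢w′ ∘ sym) x∈inner′ (there x∈)
  ... | inj₂ (here refl) | inj₂ (here Tw≡Tw′) = w≢w′ (T-injective Tw≡Tw′)

  module Ranked (π : Fin n → Fin n) (π-injective : Injective _≡_ _≡_ π) where

    position : Fin n → Fin n
    position x = proj₁ (Fin-injective⇒surjective π-injective x)

    π∘position : ∀ x → π (position x) ≡ x
    π∘position x = proj₂ (Fin-injective⇒surjective π-injective x)

    rank : Fin m → ℕ
    rank u = toℕ (position (T u))

    rank-injective : Injective _≡_ _≡_ rank
    rank-injective {u} {w} eq = T-injective (begin
      T u                ≡⟨ sym (π∘position (T u)) ⟩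
      π (position (T u)) ≡⟨ cong π (toℕ-injective eq) ⟩
      π (position (T w)) ≡⟨ π∘position (T w) ⟩
      T w                ∎)
      where open ≡-Reasoning

    Prefix? : ∀ i → Decidable (Prefix π i)
    Prefix? i x = any? (λ j → toℕ j ≤? toℕ i ×-dec π j ≟ x)

    lowerBranch : ∀ {u w} → Adj H u w × rank w < rank u →
                  Branch (suc (2 * r)) G (T u) (Prefix π (position (T u))) (inner u w ++ T w ∷ [])
    lowerBranch {u} {w} (uw , w<u) with inner-path uw
    ... | path , short = path , short′ , ++⁺ʳ (inner u w) (here (position (T w) , <⇒≤ w<u , π∘position (T w)))
      where
      short′ : length (inner u w ++ T w ∷ []) ≤ suc (2 * r)
      short′ = subst (_≤ suc (2 * r)) (trans (+-comm 1 _) (sym (length-++ (inner u w)))) (s≤s short)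

    lowerBranches : Fin m → List (List (Fin n))
    lowerBranches u = map (λ w → inner u w ++ T w ∷ []) (lowerNeighbours H rank u)

    lowerFan : ∀ u → Fan (suc (2 * r)) G (T u) (Prefix π (position (T u)))
                         (map (truncate (Prefix? (position (T u))) (T u)) (lowerBranches u))
    lowerFan u = fanOfBranches (Prefix? (position (T u))) (T u) {suc (2 * r)} {G} {lowerBranches u}
      (All-map⁺ {f = λ w → inner u w ++ T w ∷ []} (All.map (lowerBranch {u}) (lowerNeighbours-lower H rank u)))
      (AllPairs-map⁺ (AllPairs-zip (λ (uw , _) (uw′ , _) → star-disjoint {u} uw uw′)
                                   (lowerNeighbours-lower H rank u) (lowerNeighbours-unique H rank u)))

    lowerDegree-≤ : ∀ {k} → (∀ i ps → Fan (suc (2 * r)) G (π i) (Prefix π i) ps → length ps ≤ k) →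
                    ∀ u → lowerDegree H rank u ≤ k
    lowerDegree-≤ {k} fan-≤ u = subst (_≤ k) sameLength (fan-≤ (position (T u)) _ fanAtπ)
      where
      i = position (T u)
      fanPaths = map (truncate (Prefix? i) (T u)) (lowerBranches u)
      fanAtπ : Fan (suc (2 * r)) G (π i) (Prefix π i) fanPaths
      fanAtπ = subst (λ v → Fan (suc (2 * r)) G v (Prefix π i) fanPaths) (sym (π∘position (T u))) (lowerFan u)
      sameLength : length fanPaths ≡ lowerDegree H rank u
      sameLength = trans (length-map _ (lowerBranches u)) (length-map _ (lowerNeighbours H rank u))

mainTheorem7 : ∀ {n} (G : Graph n) (r : ℕ) → 1 ≤ r →
    ∀ (k : ℕ) → AdmAtMost (suc (2 * r)) G k →
    ∀ {m} (H : Graph m) → TopMinor r H G → edgeCount H ≤ k * m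
mainTheorem7 G r _ k (π , π-injective , fan-≤) {m} H (T , T-injective , P , edgePath , internallyDisjoint) = begin
  edgeCount H                     ≡⟨ edgeCount≡∑lowerDegree H rank rank-injective ⟩
  ∑[ u < m ] lowerDegree H rank u ≤⟨ ∑-bounded _ (lowerDegree-≤ fan-≤) ⟩
  m * k                           ≡⟨ *-comm m k ⟩
  k * m                           ∎
  where
  open ≤-Reasoning
  open MinorModel {r = r} {H} {G} T T-injective P edgePath internallyDisjoint
  open Ranked π π-injective
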